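{- Let $q$ be a prime power and $n\ge 1$. Let $A$ be an $n\times n$ Dickson matrix over $\mathbb{F}_{q^n}$ such that $\mathrm{rank}\,(A+\mathrm{diag}(d,d^q,\dots,d^{q^{n-1}}))=1$ for some $d\in\mathbb{F}_{q^n}$, and let $B$ be an $n\times n$ Dickson matrix such that $A$ and $B$ have equal corresponding principal minors of all orders. Then $A$ is diagonally similar to $B$.
   Context: A Dickson matrix is an $n\times n$ matrix $A$ indexed by $\mathbb{Z}_n$ with $A[i|j]=a_{j-i}^{q^i}$ for some $a_0,\dots,a_{n-1}\in\mathbb{F}_{q^n}$. Equal corresponding principal minors: $\det A[\alpha|\alpha]=\det B[\alpha|\alpha]$ for all $\alpha\subseteq\mathbb{Z}_n$. $A$ is diagonally similar to $B$ if $B=D^{ -1}AD$ for some invertible diagonal matrix $D$. -}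

module Defs where

open import Level using (Level; _⊔_)
open import Algebra.Bundles using (CommutativeRing)
open import Data.Nat as ℕ using (ℕ; zero; suc; NonZero; _≥_)
open import Data.Nat.DivMod using (_mod_)
open import Data.Nat.Primality using (Prime)
open import Data.Fin using (Fin; zero; suc; toℕ; punchIn)
open import Data.Fin.Subset using (Subset)
open import Data.Vec using ([]; _∷_)
open import Data.Bool using (true; false)
open import Data.List using (List; []; _∷_; map; length; lookup)
open import Data.Product using (Σ; ∃; ∃-syntax; _×_; _,_)
open import Relation.Nullary using (¬_)
open import Relation.Binary.PropositionalEquality using (_≡_)
import Relation.Binary.PropositionalEquality as ≡
open import Function.Bundles using (Bijection)
open import Function.Definitions using (Injective)

IsPrimePower : ℕ → Set
IsPrimePower q = ∃[ p ] ∃[ k ] (Prime p × k ≥ 1 × q ≡ p ℕ.^ k)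

_⊖_ : ∀ {n} .{{_ : NonZero n}} → Fin n → Fin n → Fin n
_⊖_ {n} j i = (n ℕ.+ toℕ j ℕ.∸ toℕ i) mod n

elems : ∀ {n} → Subset n → List (Fin n)
elems []          = []
elems (true ∷ p)  = zero ∷ map suc (elems p)
elems (false ∷ p) = map suc (elems p)

module Over {c ℓ : Level} (R : CommutativeRing c ℓ) where
  open CommutativeRing R using (Carrier; _≈_; _+_; _*_; -_; 0#; 1#; setoid)

  Matrix : ℕ → Set c
  Matrix n = Fin n → Fin n → Carrier

  pow : Carrier → ℕ → Carrier
  pow x zero    = 1#
  pow x (suc k) = x * pow x k

  sum : ∀ {n} → (Fin n → Carrier) → Carrier
  sum {zero}  f = 0#
  sum {suc n} f = f zero + sum (λ i → f (suc i))

  sgn : ℕ → Carrier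
  sgn zero    = 1#
  sgn (suc k) = - sgn k

  det : ∀ {n} → Matrix n → Carrier
  det {zero}  M = 1#
  det {suc n} M = sum λ j → sgn (toℕ j) * (M zero j * det (λ r s → M (suc r) (punchIn j s)))

  _≈ᴹ_ : ∀ {n} → Matrix n → Matrix n → Set ℓ
  A ≈ᴹ B = ∀ i j → A i j ≈ B i j

  _+ᴹ_ : ∀ {n} → Matrix n → Matrix n → Matrix n
  (A +ᴹ B) i j = A i j + B i j

  _*ᴹ_ : ∀ {n} → Matrix n → Matrix n → Matrix n
  (A *ᴹ B) i j = sum λ k → A i k * B k j

  I : ∀ {n} → Matrix n
  I i j with i Data.Fin.≟ j
  ... | Relation.Nullary.yes _ = 1#
  ... | Relation.Nullary.no  _ = 0#

  diag : ∀ {n} → (Fin n → Carrier) → Matrix n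
  diag d i j with i Data.Fin.≟ j
  ... | Relation.Nullary.yes _ = d i
  ... | Relation.Nullary.no  _ = 0#

  record IsField : Set (c ⊔ ℓ) where
    field
      0≉1     : ¬ (0# ≈ 1#)
      inverse : ∀ x → ¬ (x ≈ 0#) → ∃[ y ] (x * y ≈ 1#)

  HasCardinality : ℕ → Set (c ⊔ ℓ)
  HasCardinality N = Bijection (≡.setoid (Fin N)) setoid

  IsDickson : ∀ (q : ℕ) {n} .{{_ : NonZero n}} → Matrix n → Set (c ⊔ ℓ)
  IsDickson q {n} A = Σ (Fin n → Carrier) λ a → (∀ (i j : Fin n) → A i j ≈ pow (a (j ⊖ i)) (q ℕ.^ toℕ i))

  subMatrix : ∀ {n r} → Matrix n → (Fin r → Fin n) → (Fin r → Fin n) → Matrix r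
  subMatrix M ρ κ i j = M (ρ i) (κ j)

  HasRank : ∀ {n} → Matrix n → ℕ → Set ℓ
  HasRank {n} M r =
    (∃[ ρ ] ∃[ κ ] (Injective _≡_ _≡_ ρ × Injective _≡_ _≡_ κ × ¬ (det (subMatrix {r = r} M ρ κ) ≈ 0#)))
    × (∀ (ρ κ : Fin (suc r) → Fin n) → Injective _≡_ _≡_ ρ → Injective _≡_ _≡_ κ
         → det (subMatrix M ρ κ) ≈ 0#)

  principal : ∀ {n} → Matrix n → (α : Subset n) → Matrix (length (elems α))
  principal M α = subMatrix M (lookup (elems α)) (lookup (elems α))

  EqualPrincipalMinors : ∀ {n} → Matrix n → Matrix n → Set ℓ
  EqualPrincipalMinors {n} A B = ∀ (α : Subset n) → det (principal A α) ≈ det (principal B α)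

  DiagonallySimilar : ∀ {n} → Matrix n → Matrix n → Set (c ⊔ ℓ)
  DiagonallySimilar {n} A B =
    Σ (Fin n → Carrier) λ δ → Σ (Matrix n) λ E → ((diag δ *ᴹ E) ≈ᴹ I × (E *ᴹ diag δ) ≈ᴹ I × B ≈ᴹ ((E *ᴹ A) *ᴹ diag δ))

-- Put C = A + diag(d, d^q, …, d^(q^(n-1))). Its vanishing 2 × 2 minors give C i j · C k l = C i l · C k j,
-- so C has no zero entry once every row and every column has a nonzero one. The Dickson structure
-- provides this: the entries of C on a cyclic diagonal j - i = k ≠ 0 are Frobenius twists a_k^(q^i) of one
-- another, and a diagonal entry C i i = a₀^(q^i) + d^(q^i) vanishes exactly when a₀ = -d, whatever i is.
-- Hence A has no zero off-diagonal entry and its 3-cycles through 0 are symmetric: A₀ᵤ Aᵤᵥ Aᵥ₀ = A₀ᵥ Aᵥᵤ Aᵤ₀.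
-- Equal principal minors of orders 1, 2 and 3 give equal diagonals, equal 2-cycle products Aᵢⱼ Aⱼᵢ and equal
-- sums of the two 3-cycles through 0. The 3-cycles x, x′ of B therefore have sum 2y and product y², where y
-- is the 3-cycle of A, so x = x′ = y. After rescaling so that the first rows of A and B agree, all entries agree.

module Submission where

open import Defs
open import Level using (Level)
open import Algebra.Bundles using (CommutativeRing)
open import Data.Nat as ℕ using (ℕ; NonZero; _^_)
open import Data.Fin using (Fin; toℕ)
open import Data.Product using (∃-syntax; _×_; _,_; proj₁)
open import Function.Bundles using (Bijection)
open import Relation.Binary.PropositionalEquality as ≡ using (_≡_)

-- The library's ring solver over an arbitrary commutative ring; its coefficients must normalise
-- by evaluation, so they are taken from ℤ rather than from the ring itself.
module IntegerCoefficientSolver {c ℓ} (R : CommutativeRing c ℓ) where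
  open import Data.Maybe using (Maybe; just; nothing)
  open import Data.Nat using (suc)
  open import Data.Integer as ℤ using (ℤ; +_; -[1+_])
  open import Data.Integer.Properties using ([1+m]⊖[1+n]≡m⊖n)
  open import Data.Nat.Properties using (+-suc)
  open import Data.Sign as Sign using (Sign)
  open import Relation.Nullary using (yes; no)
  open import Algebra.Solver.Ring.AlmostCommutativeRing
    using (fromCommutativeRing; _-Raw-AlmostCommutative⟶_)
  open CommutativeRing R
  open import Algebra.Properties.Semiring.Mult.TCOptimised semiring renaming (_×_ to _·_) using (1+×; ×-homo-+; ×1-homo-*)
  open import Algebra.Properties.Ring ring using (-‿distribˡ-*; -‿distribʳ-*)
  open import Algebra.Properties.AbelianGroup +-abelianGroup using (⁻¹-∙-comm; ε⁻¹≈ε; ⁻¹-involutive)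
  open import Relation.Binary.Reasoning.Setoid setoid

  private module Embedding where
    ⟦_⟧ : ℤ → Carrier
    ⟦ + n ⟧      = n · 1#
    ⟦ -[1+ n ] ⟧ = - (suc n · 1#)

    signed : Sign → Carrier → Carrier
    signed Sign.+ x = x
    signed Sign.- x = - x

    ◃-homo : ∀ s n → ⟦ s ℤ.◃ n ⟧ ≈ signed s (n · 1#)
    ◃-homo Sign.+ ℕ.zero    = refl
    ◃-homo Sign.- ℕ.zero    = sym ε⁻¹≈ε
    ◃-homo Sign.+ (suc n)   = refl
    ◃-homo Sign.- (suc n)   = refl

    -‿homo : ∀ i → ⟦ ℤ.- i ⟧ ≈ - ⟦ i ⟧
    -‿homo (+ ℕ.zero)  = sym ε⁻¹≈ε
    -‿homo (+ suc n)   = refl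
    -‿homo -[1+ n ]    = sym (⁻¹-involutive _)

    ⊖-homo : ∀ m n → ⟦ m ℤ.⊖ n ⟧ ≈ m · 1# - n · 1#
    ⊖-homo m       ℕ.zero  = sym (trans (+-congˡ ε⁻¹≈ε) (+-identityʳ _))
    ⊖-homo ℕ.zero  (suc n) = sym (+-identityˡ _)
    ⊖-homo (suc m) (suc n) = begin
      ⟦ suc m ℤ.⊖ suc n ⟧                  ≡⟨ ≡.cong ⟦_⟧ ([1+m]⊖[1+n]≡m⊖n m n) ⟩
      ⟦ m ℤ.⊖ n ⟧                          ≈⟨ ⊖-homo m n ⟩
      m · 1# - n · 1#                      ≈⟨ shift 1# (m · 1#) (n · 1#) ⟩
      (1# + m · 1#) - (1# + n · 1#)        ≈⟨ sym (+-cong (1+× m 1#) (-‿cong (1+× n 1#))) ⟩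
      suc m · 1# - suc n · 1#              ∎
      where
      shift : ∀ x y z → y - z ≈ (x + y) - (x + z)
      shift x y z = begin
        y - z                        ≈⟨ sym (+-identityˡ _) ⟩
        0# + (y - z)                 ≈⟨ +-congʳ (sym (-‿inverseʳ x)) ⟩
        (x - x) + (y - z)            ≈⟨ +-assoc x (- x) (y - z) ⟩
        x + (- x + (y - z))          ≈⟨ +-congˡ (trans (+-comm (- x) _) (+-assoc y (- z) (- x))) ⟩
        x + (y + (- z + - x))        ≈⟨ sym (+-assoc x y _) ⟩
        (x + y) + (- z + - x)        ≈⟨ +-congˡ (trans (+-comm _ _) (⁻¹-∙-comm x z)) ⟩
        (x + y) - (x + z)            ∎

    +-homo : ∀ i j → ⟦ i ℤ.+ j ⟧ ≈ ⟦ i ⟧ + ⟦ j ⟧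
    +-homo (+ m)     (+ n)     = ×-homo-+ 1# m n
    +-homo (+ m)     -[1+ n ]  = ⊖-homo m (suc n)
    +-homo -[1+ m ]  (+ n)     = trans (⊖-homo n (suc m)) (+-comm _ _)
    +-homo -[1+ m ]  -[1+ n ]  = begin
      - (suc (suc (m ℕ.+ n)) · 1#)         ≡⟨ ≡.cong (λ k → - (suc k · 1#)) (≡.sym (+-suc m n)) ⟩
      - ((suc m ℕ.+ suc n) · 1#)           ≈⟨ -‿cong (×-homo-+ 1# (suc m) (suc n)) ⟩
      - (suc m · 1# + suc n · 1#)          ≈⟨ sym (⁻¹-∙-comm _ _) ⟩
      - (suc m · 1#) + - (suc n · 1#)      ∎

    *-homo : ∀ i j → ⟦ i ℤ.* j ⟧ ≈ ⟦ i ⟧ * ⟦ j ⟧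
    *-homo (+ m)     (+ n)     = trans (◃-homo Sign.+ (m ℕ.* n)) (×1-homo-* m n)
    *-homo (+ m)     -[1+ n ]  = begin
      ⟦ Sign.- ℤ.◃ m ℕ.* suc n ⟧           ≈⟨ ◃-homo Sign.- (m ℕ.* suc n) ⟩
      - ((m ℕ.* suc n) · 1#)               ≈⟨ -‿cong (×1-homo-* m (suc n)) ⟩
      - (m · 1# * suc n · 1#)              ≈⟨ -‿distribʳ-* _ _ ⟩
      m · 1# * - (suc n · 1#)              ∎
    *-homo -[1+ m ]  (+ n)     = begin
      ⟦ Sign.- ℤ.◃ suc m ℕ.* n ⟧           ≈⟨ ◃-homo Sign.- (suc m ℕ.* n) ⟩
      - ((suc m ℕ.* n) · 1#)               ≈⟨ -‿cong (×1-homo-* (suc m) n) ⟩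
      - (suc m · 1# * n · 1#)              ≈⟨ -‿distribˡ-* _ _ ⟩
      - (suc m · 1#) * n · 1#              ∎
    *-homo -[1+ m ]  -[1+ n ]  = begin
      (suc m ℕ.* suc n) · 1#               ≈⟨ ×1-homo-* (suc m) (suc n) ⟩
      suc m · 1# * suc n · 1#              ≈⟨ sym (⁻¹-involutive _) ⟩
      - - (suc m · 1# * suc n · 1#)        ≈⟨ -‿cong (trans (-‿distribˡ-* _ _) (*-congˡ (sym (⁻¹-involutive _)))) ⟩
      - (- (suc m · 1#) * - - (suc n · 1#)) ≈⟨ trans (-‿distribʳ-* _ _) (*-congˡ (⁻¹-involutive _)) ⟩
      - (suc m · 1#) * - (suc n · 1#)      ∎

    homomorphism : ℤ.+-*-rawRing -Raw-AlmostCommutative⟶ fromCommutativeRing R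
    homomorphism = record
      { ⟦_⟧ = ⟦_⟧ ; +-homo = +-homo ; *-homo = *-homo ; -‿homo = -‿homo
      ; 0-homo = refl ; 1-homo = refl }

    coefficients≟ : ∀ i j → Maybe (⟦ i ⟧ ≈ ⟦ j ⟧)
    coefficients≟ i j with i ℤ.≟ j
    ... | yes ≡.refl = just refl
    ... | no _       = nothing

  open import Algebra.Solver.Ring ℤ.+-*-rawRing (fromCommutativeRing R) Embedding.homomorphism Embedding.coefficients≟ public

module CyclicIndices {m : ℕ} where
  open import Data.Nat using (suc; _+_; _∸_; _%_; _<_; _≤?_; _<?_)
  open import Data.Nat.Properties
  open import Data.Nat.DivMod using ([m+n]%n≡m%n; m<n⇒m%n≡m)
  open import Data.Nat.Solver using (module +-*-Solver)
  open +-*-Solver using (solve; _:=_; _:+_)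
  open import Data.Fin using (zero; fromℕ<)
  open import Data.Fin.Properties using (toℕ-fromℕ<; toℕ-injective; toℕ<n)
  open import Data.Product using (∃; _,_)
  open import Data.Sum using (_⊎_; inj₁; inj₂; [_,_]′)
  open import Relation.Nullary using (yes; no; contradiction)
  open import Relation.Binary.PropositionalEquality
  open ≡-Reasoning

  private
    n : ℕ
    n = suc m

  toℕ-⊖ : ∀ {i j : Fin n} x → n + toℕ j ≡ toℕ i + x → toℕ (j ⊖ i) ≡ x % n
  toℕ-⊖ {i} x e = trans (toℕ-fromℕ< _) (cong (_% n) (trans (cong (_∸ toℕ i) e) (m+n∸m≡n (toℕ i) x)))

  ⊖-unique : ∀ {i j k : Fin n} → toℕ i + toℕ k ≡ toℕ j ⊎ toℕ i + toℕ k ≡ n + toℕ j → j ⊖ i ≡ k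
  ⊖-unique {i} {j} {k} (inj₁ e) = toℕ-injective (begin
    toℕ (j ⊖ i)       ≡⟨ toℕ-⊖ {i} {j} (toℕ k + n) (trans (cong (n +_) (sym e)) (rearrange n (toℕ i) (toℕ k))) ⟩
    (toℕ k + n) % n   ≡⟨ [m+n]%n≡m%n (toℕ k) n ⟩
    toℕ k % n         ≡⟨ m<n⇒m%n≡m (toℕ<n k) ⟩
    toℕ k             ∎)
    where rearrange = solve 3 (λ n i k → n :+ (i :+ k) := i :+ (k :+ n)) refl
  ⊖-unique {i} {j} {k} (inj₂ e) = toℕ-injective
    (trans (toℕ-⊖ {i} {j} (toℕ k) (sym e)) (m<n⇒m%n≡m (toℕ<n k)))

  private
    wrap< : ∀ {i j : Fin n} → toℕ j < toℕ i → n + toℕ j ∸ toℕ i < n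
    wrap< {i} {j} j<i = m<n+o⇒m∸n<o (n + toℕ j) (toℕ i) (subst (n + toℕ j <_) (+-comm n (toℕ i)) (+-monoʳ-< n j<i))

  ⊖-complement : ∀ (i j : Fin n) → toℕ i + toℕ (j ⊖ i) ≡ toℕ j ⊎ toℕ i + toℕ (j ⊖ i) ≡ n + toℕ j
  ⊖-complement i j with toℕ i ≤? toℕ j
  ... | yes i≤j = inj₁ (begin
    toℕ i + toℕ (j ⊖ i)   ≡⟨ cong (toℕ i +_) (toℕ-⊖ {i} {j} (δ + n) unwrapped) ⟩
    toℕ i + (δ + n) % n   ≡⟨ cong (toℕ i +_) ([m+n]%n≡m%n δ n) ⟩
    toℕ i + δ % n         ≡⟨ cong (toℕ i +_) (m<n⇒m%n≡m (≤-<-trans (m∸n≤m (toℕ j) (toℕ i)) (toℕ<n j))) ⟩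
    toℕ i + δ             ≡⟨ m+[n∸m]≡n i≤j ⟩
    toℕ j                 ∎)
    where
    δ : ℕ
    δ = toℕ j ∸ toℕ i
    unwrapped : n + toℕ j ≡ toℕ i + (δ + n)
    unwrapped = begin
      n + toℕ j             ≡⟨ cong (n +_) (sym (m+[n∸m]≡n i≤j)) ⟩
      n + (toℕ i + δ)       ≡⟨ solve 3 (λ n i δ → n :+ (i :+ δ) := i :+ (δ :+ n)) refl n (toℕ i) δ ⟩
      toℕ i + (δ + n)       ∎
  ... | no i≰j = inj₂ (begin
    toℕ i + toℕ (j ⊖ i)       ≡⟨ cong (toℕ i +_) (trans (toℕ-⊖ {i} {j} _ unwrapped) (m<n⇒m%n≡m (wrap< (≰⇒> i≰j)))) ⟩
    toℕ i + (n + toℕ j ∸ toℕ i) ≡⟨ sym unwrapped ⟩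
    n + toℕ j                 ∎)
    where
    unwrapped : n + toℕ j ≡ toℕ i + (n + toℕ j ∸ toℕ i)
    unwrapped = sym (m+[n∸m]≡n (≤-trans (<⇒≤ (toℕ<n i)) (m≤m+n n (toℕ j))))

  ⊖-self : ∀ (i : Fin n) → i ⊖ i ≡ zero
  ⊖-self i = ⊖-unique (inj₁ (+-identityʳ (toℕ i)))

  ⊖≡zero⇒≡ : ∀ {i j : Fin n} → j ⊖ i ≡ zero → j ≡ i
  ⊖≡zero⇒≡ {i} {j} e = [ (λ i+[j⊖i]≡j → toℕ-injective (trans (sym i+[j⊖i]≡j) i+[j⊖i]≡i))
                        , (λ i+[j⊖i]≡n+j → contradiction (subst (_< n) (trans (sym i+[j⊖i]≡i) i+[j⊖i]≡n+j) (toℕ<n i))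
                                                         (m+n≮m n (toℕ j)))
                        ]′ (⊖-complement i j)
    where
    i+[j⊖i]≡i : toℕ i + toℕ (j ⊖ i) ≡ toℕ i
    i+[j⊖i]≡i = trans (cong (λ k → toℕ i + toℕ k) e) (+-identityʳ (toℕ i))

  ∃-⊖≡ʳ : ∀ (i k : Fin n) → ∃ λ j → j ⊖ i ≡ k
  ∃-⊖≡ʳ i k with toℕ i + toℕ k <? n
  ... | yes lt = fromℕ< lt , ⊖-unique (inj₁ (sym (toℕ-fromℕ< lt)))
  ... | no ≮ = fromℕ< lt , ⊖-unique (inj₂ (begin
    toℕ i + toℕ k                 ≡⟨ sym (m+[n∸m]≡n (≮⇒≥ ≮)) ⟩
    n + (toℕ i + toℕ k ∸ n)       ≡⟨ cong (n +_) (sym (toℕ-fromℕ< lt)) ⟩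
    n + toℕ (fromℕ< lt)           ∎))
    where
    lt : toℕ i + toℕ k ∸ n < n
    lt = m<n+o⇒m∸n<o (toℕ i + toℕ k) n (+-mono-< (toℕ<n i) (toℕ<n k))

  ∃-⊖≡ˡ : ∀ (j k : Fin n) → ∃ λ i → j ⊖ i ≡ k
  ∃-⊖≡ˡ j k with toℕ k ≤? toℕ j
  ... | yes k≤j = fromℕ< lt , ⊖-unique (inj₁ (trans (cong (_+ toℕ k) (toℕ-fromℕ< lt)) (m∸n+n≡m k≤j)))
    where
    lt : toℕ j ∸ toℕ k < n
    lt = ≤-<-trans (m∸n≤m (toℕ j) (toℕ k)) (toℕ<n j)
  ... | no k≰j = fromℕ< lt , ⊖-unique (inj₂ (trans (cong (_+ toℕ k) (toℕ-fromℕ< lt))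
                   (m∸n+n≡m (≤-trans (<⇒≤ (toℕ<n k)) (m≤m+n n (toℕ j))))))
    where
    lt : n + toℕ j ∸ toℕ k < n
    lt = wrap< {k} {j} (≰⇒> k≰j)

module SubsetElements where
  open import Data.Fin using (zero; suc; _<_)
  open import Data.Fin.Subset using (⁅_⁆; _∪_) renaming (⊥ to ∅)
  open import Data.Fin.Subset.Properties using (∪-identityˡ)
  open import Data.List using ([]; _∷_; map)
  open import Relation.Binary.PropositionalEquality using (_≡_; refl; cong; trans)

  elems-∅ : ∀ {n} → elems (∅ {n}) ≡ []
  elems-∅ {ℕ.zero}  = refl
  elems-∅ {ℕ.suc n} = cong (map suc) (elems-∅ {n})

  elems-⁅⁆ : ∀ {n} (i : Fin n) → elems ⁅ i ⁆ ≡ i ∷ []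
  elems-⁅⁆ zero    = cong (λ xs → zero ∷ map suc xs) elems-∅
  elems-⁅⁆ (suc i) = cong (map suc) (elems-⁅⁆ i)

  elems-⁅⁆∪⁅⁆ : ∀ {n} {i j : Fin n} → i < j → elems (⁅ i ⁆ ∪ ⁅ j ⁆) ≡ i ∷ j ∷ []
  elems-⁅⁆∪⁅⁆ {i = zero}  {suc j} _   =
    trans (cong (λ p → zero ∷ map suc (elems p)) (∪-identityˡ ⁅ j ⁆)) (cong (λ xs → zero ∷ map suc xs) (elems-⁅⁆ j))
  elems-⁅⁆∪⁅⁆ {i = suc i} {suc j} i<j = cong (map suc) (elems-⁅⁆∪⁅⁆ (ℕ.s<s⁻¹ i<j))

module PowerLaws {c ℓ} (R : CommutativeRing c ℓ) where
  open CommutativeRing R hiding (zero)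
  open Over R
  open import Algebra.Properties.CommutativeSemiring.Exp commutativeSemiring
    renaming (_^_ to _^ᴿ_) using (^-congˡ; ^-assocʳ; ^-distrib-*)

  pow≡^ : ∀ x k → pow x k ≡ x ^ᴿ k
  pow≡^ x ℕ.zero    = ≡.refl
  pow≡^ x (ℕ.suc k) = ≡.cong (x *_) (pow≡^ x k)

  pow-congˡ : ∀ k {x y} → x ≈ y → pow x k ≈ pow y k
  pow-congˡ k {x} {y} rewrite pow≡^ x k | pow≡^ y k = ^-congˡ k

  pow-assocʳ : ∀ x k l → pow (pow x k) l ≈ pow x (k ℕ.* l)
  pow-assocʳ x k l rewrite pow≡^ (pow x k) l | pow≡^ x k | pow≡^ x (k ℕ.* l) = ^-assocʳ x k l

  pow-distrib-* : ∀ x y k → pow (x * y) k ≈ pow x k * pow y k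
  pow-distrib-* x y k rewrite pow≡^ (x * y) k | pow≡^ x k | pow≡^ y k = ^-distrib-* x y k

  pow-1# : ∀ k → pow 1# k ≈ 1#
  pow-1# ℕ.zero    = refl
  pow-1# (ℕ.suc k) = trans (*-identityˡ _) (pow-1# k)

  pow-0# : ∀ k .{{_ : ℕ.NonZero k}} → pow 0# k ≈ 0#
  pow-0# (ℕ.suc k) = zeroˡ _

module Determinants {c ℓ} (R : CommutativeRing c ℓ) where
  open CommutativeRing R hiding (zero)
  open Over R
  open IntegerCoefficientSolver R using (Polynomial; var; con; _:+_; _:*_; :-_; _:-_; prove)
  open import Algebra.Solver.CommutativeMonoid *-commutativeMonoid using (_⊕_; _⊜_) renaming (solve to ⊙-solve)
  open import Data.Fin using (zero; suc; punchIn; combine)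
  open import Data.Fin.Patterns using (0F; 1F; 2F)
  open import Data.Integer using (+_)
  open import Data.Vec using (Vec; concat; tabulate)

  cycle₃ : ∀ {n} → Matrix n → Fin n → Fin n → Fin n → Carrier
  cycle₃ X i j k = X i j * X j k * X k i

  cycle₃*reversed : ∀ {n} (X : Matrix n) i j k →
    cycle₃ X i j k * cycle₃ X i k j ≈ (X i j * X j i) * (X j k * X k j) * (X k i * X i k)
  cycle₃*reversed X i j k = ⊙-solve 6 (λ a b c d e f → ((a ⊕ b) ⊕ c) ⊕ ((d ⊕ e) ⊕ f) ⊜ ((a ⊕ f) ⊕ (b ⊕ e)) ⊕ (c ⊕ d))
    refl (X i j) (X j k) (X k i) (X i k) (X k j) (X j i)

  private
    sumPoly : ∀ {v k} → (Fin k → Polynomial v) → Polynomial v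
    sumPoly {k = ℕ.zero}  f = con (+ 0)
    sumPoly {k = ℕ.suc k} f = f zero :+ sumPoly (λ i → f (suc i))

    sgnPoly : ∀ {v} → ℕ → Polynomial v
    sgnPoly ℕ.zero    = con (+ 1)
    sgnPoly (ℕ.suc k) = :- sgnPoly k

    detPoly : ∀ {v k} → (Fin k → Fin k → Polynomial v) → Polynomial v
    detPoly {k = ℕ.zero}  P = con (+ 1)
    detPoly {k = ℕ.suc k} P = sumPoly λ j → sgnPoly (toℕ j) :* (P zero j :* detPoly (λ r s → P (suc r) (punchIn j s)))

    entries : ∀ {k} → Matrix k → Vec Carrier (k ℕ.* k)
    entries M = concat (tabulate λ r → tabulate (M r))

    entry : ∀ {k} → Fin k → Fin k → Polynomial (k ℕ.* k)
    entry r s = var (combine r s)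

    detPolyₖ : ∀ k → Polynomial (k ℕ.* k)
    detPolyₖ k = detPoly {k = k} entry

  det₁ : (M : Matrix 1) → det M ≈ M 0F 0F
  det₁ M = prove (entries M) (detPolyₖ 1) (var zero) refl

  det₂ : (M : Matrix 2) → det M ≈ M 0F 0F * M 1F 1F - M 0F 1F * M 1F 0F
  det₂ M = prove (entries M) (detPolyₖ 2) (e 0F 0F :* e 1F 1F :- e 0F 1F :* e 1F 0F) refl
    where
    e : Fin 2 → Fin 2 → Polynomial 4
    e = entry

  det₃ : (M : Matrix 3) → det M ≈ (M 0F 0F * M 1F 1F * M 2F 2F
                                   - (M 0F 0F * (M 1F 2F * M 2F 1F) + M 1F 1F * (M 0F 2F * M 2F 0F) + M 2F 2F * (M 0F 1F * M 1F 0F)))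
                                  + (cycle₃ M 0F 1F 2F + cycle₃ M 0F 2F 1F)
  det₃ M = prove (entries M) (detPolyₖ 3)
    ((e 0F 0F :* e 1F 1F :* e 2F 2F :- (e 0F 0F :* (e 1F 2F :* e 2F 1F) :+ e 1F 1F :* (e 0F 2F :* e 2F 0F) :+ e 2F 2F :* (e 0F 1F :* e 1F 0F)))
      :+ (e 0F 1F :* e 1F 2F :* e 2F 0F :+ e 0F 2F :* e 2F 1F :* e 1F 0F)) refl
    where
    e : Fin 3 → Fin 3 → Polynomial 9
    e = entry

module DiagonalScaling {c ℓ} (R : CommutativeRing c ℓ) where
  open CommutativeRing R hiding (zero)
  open Over R
  open import Data.Fin as Fin using (zero; suc)
  open import Data.Fin.Properties using (suc-injective)
  open import Data.Product using (_,_)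
  open import Function using (_∘_)
  open import Relation.Nullary using (yes; no; contradiction)
  open import Relation.Binary.PropositionalEquality as ≡ using (_≡_; _≢_)

  private
    sum-zero : ∀ {k} (f : Fin k → Carrier) → (∀ j → f j ≈ 0#) → sum f ≈ 0#
    sum-zero {ℕ.zero}  f f≈0 = refl
    sum-zero {ℕ.suc k} f f≈0 = trans (+-cong (f≈0 zero) (sum-zero (λ j → f (suc j)) (λ j → f≈0 (suc j)))) (+-identityˡ 0#)

    sum-single : ∀ {k} (f : Fin k → Carrier) i → (∀ j → j ≢ i → f j ≈ 0#) → sum f ≈ f i
    sum-single f zero    f≈0 = trans (+-congˡ (sum-zero (λ j → f (suc j)) (λ j → f≈0 (suc j) λ ()))) (+-identityʳ _)
    sum-single f (suc i) f≈0 = trans (+-cong (f≈0 zero λ ()) (sum-single (λ j → f (suc j)) i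
                                 (λ j j≢i → f≈0 (suc j) (j≢i ∘ suc-injective)))) (+-identityˡ _)

    diag-off : ∀ {n} (δ : Fin n → Carrier) {i j} → i ≢ j → diag δ i j ≈ 0#
    diag-off δ {i} {j} i≢j with i Fin.≟ j
    ... | yes i≡j = contradiction i≡j i≢j
    ... | no _    = refl

    diag-on : ∀ {n} (δ : Fin n → Carrier) i → diag δ i i ≈ δ i
    diag-on δ i with i Fin.≟ i
    ... | yes _   = refl
    ... | no i≢i  = contradiction ≡.refl i≢i

  diag-*ᴹ : ∀ {n} (δ : Fin n → Carrier) (X : Matrix n) i j → (diag δ *ᴹ X) i j ≈ δ i * X i j
  diag-*ᴹ δ X i j = trans (sum-single _ i λ k k≢i → trans (*-congʳ (diag-off δ (k≢i ∘ ≡.sym))) (zeroˡ _))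
                          (*-congʳ (diag-on δ i))

  *ᴹ-diag : ∀ {n} (δ : Fin n → Carrier) (X : Matrix n) i j → (X *ᴹ diag δ) i j ≈ X i j * δ j
  *ᴹ-diag δ X i j = trans (sum-single _ j λ k k≢j → trans (*-congˡ (diag-off δ k≢j)) (zeroʳ _))
                          (*-congˡ (diag-on δ j))

  diag-inverse : ∀ {n} (δ ε : Fin n → Carrier) → (∀ i → δ i * ε i ≈ 1#) → (diag δ *ᴹ diag ε) ≈ᴹ I
  diag-inverse δ ε δε≈1 i j with i Fin.≟ j | diag-*ᴹ δ (diag ε) i j
  ... | yes ≡.refl | e = trans e (δε≈1 i)
  ... | no _       | e = trans e (zeroʳ _)

  rescaling⇒diagonallySimilar : ∀ {n} {A B : Matrix n} (δ ε : Fin n → Carrier) →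
    (∀ i → δ i * ε i ≈ 1#) → (∀ i j → B i j ≈ ε i * A i j * δ j) → DiagonallySimilar A B
  rescaling⇒diagonallySimilar {A = A} δ ε δε≈1 B≈εAδ = δ , diag ε ,
    diag-inverse δ ε δε≈1 ,
    diag-inverse ε δ (λ i → trans (*-comm _ _) (δε≈1 i)) ,
    λ i j → trans (B≈εAδ i j) (sym (trans (*ᴹ-diag δ (diag ε *ᴹ A) i j) (*-congʳ (diag-*ᴹ ε A i j))))

module FieldFacts {c ℓ} (F : CommutativeRing c ℓ) (isField : Over.IsField F) where
  open CommutativeRing F hiding (zero)
  open Over F
  open IsField isField
  open import Algebra.Properties.Ring ring using ([y-z]x≈yx-zx)
  open import Algebra.Properties.Group +-group using (x≈y⇒x∙y⁻¹≈ε; x∙y⁻¹≈ε⇒x≈y)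
  open import Data.Product using (proj₁; proj₂)
  open import Relation.Binary.Reasoning.Setoid setoid

  inv : ∀ x → x ≉ 0# → Carrier
  inv x x≉0 = proj₁ (inverse x x≉0)

  *-inverseʳ : ∀ x (x≉0 : x ≉ 0#) → x * inv x x≉0 ≈ 1#
  *-inverseʳ x x≉0 = proj₂ (inverse x x≉0)

  *-inverseˡ : ∀ x (x≉0 : x ≉ 0#) → inv x x≉0 * x ≈ 1#
  *-inverseˡ x x≉0 = trans (*-comm _ _) (*-inverseʳ x x≉0)

  x≉0∧xy≈0⇒y≈0 : ∀ {x y} → x ≉ 0# → x * y ≈ 0# → y ≈ 0#
  x≉0∧xy≈0⇒y≈0 {x} {y} x≉0 xy≈0 = begin
    y                    ≈⟨ sym (*-identityˡ y) ⟩
    1# * y               ≈⟨ *-congʳ (sym (*-inverseˡ x x≉0)) ⟩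
    (inv x x≉0 * x) * y  ≈⟨ *-assoc _ _ _ ⟩
    inv x x≉0 * (x * y)  ≈⟨ *-congˡ xy≈0 ⟩
    inv x x≉0 * 0#       ≈⟨ zeroʳ _ ⟩
    0#                   ∎

  *-nonzero : ∀ {x y} → x ≉ 0# → y ≉ 0# → x * y ≉ 0#
  *-nonzero x≉0 y≉0 xy≈0 = y≉0 (x≉0∧xy≈0⇒y≈0 x≉0 xy≈0)

  pow-nonzero : ∀ {x} k → x ≉ 0# → pow x k ≉ 0#
  pow-nonzero ℕ.zero    x≉0 1≈0 = 0≉1 (sym 1≈0)
  pow-nonzero (ℕ.suc k) x≉0     = *-nonzero x≉0 (pow-nonzero k x≉0)

  *-cancelʳ : ∀ {x y z} → z ≉ 0# → x * z ≈ y * z → x ≈ y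
  *-cancelʳ {x} {y} {z} z≉0 xz≈yz = x∙y⁻¹≈ε⇒x≈y x y (x≉0∧xy≈0⇒y≈0 z≉0 (begin
    z * (x - y)    ≈⟨ *-comm z _ ⟩
    (x - y) * z    ≈⟨ [y-z]x≈yx-zx z x y ⟩
    x * z - y * z  ≈⟨ x≈y⇒x∙y⁻¹≈ε xz≈yz ⟩
    0#             ∎))

module FiniteFieldFacts {c ℓ} (F : CommutativeRing c ℓ) (isField : Over.IsField F)
                        {M : ℕ} (card : Over.HasCardinality F (ℕ.suc M)) where
  open CommutativeRing F hiding (zero)
  open Over F
  open IsField isField
  open FieldFacts F isField
  open PowerLaws F
  open IntegerCoefficientSolver F using (solve; _:=_; _:*_; _:+_; _:-_; :-_; con)
  open import Algebra.Properties.Ring ring using (-1*x≈-x)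
  open import Algebra.Properties.Group +-group using (x≈y⇒x∙y⁻¹≈ε; x∙y⁻¹≈ε⇒x≈y; inverseˡ-unique)
  open import Algebra.Properties.CommutativeMonoid.Sum *-commutativeMonoid
    renaming (sum to product) using (sum-permute; ∑-distrib-+; sum-cong-≋)
  import Data.Fin as Fin
  open import Data.Fin.Properties using (suc-injective)
  open import Data.Fin.Permutation using (Permutation; permutation)
  open import Data.Integer using (+_)
  open import Data.Nat.Divisibility using (_∣_; divides; quotient; 0∣⇒≡0)
  import Data.Nat.Properties as ℕP
  open import Data.Product using (_,_)
  open import Data.Sum using (_⊎_; inj₁; inj₂)
  open import Function.Bundles using (Bijection; module Surjection)
  open import Relation.Nullary using (Dec; yes; no; contradiction)
  open import Relation.Binary.PropositionalEquality as ≡ using (_≡_; _≢_)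
  open import Relation.Binary.Reasoning.Setoid setoid
  open Bijection card using (to; injective; surjection)
  open Surjection surjection using (to⁻; to∘to⁻)

  _≟_ : ∀ x y → Dec (x ≈ y)
  x ≟ y with to⁻ x Fin.≟ to⁻ y
  ... | yes e = yes (trans (sym (to∘to⁻ x)) (trans (reflexive (≡.cong to e)) (to∘to⁻ y)))
  ... | no ne = no λ x≈y → ne (injective (trans (to∘to⁻ x) (trans x≈y (sym (to∘to⁻ y)))))

  xy≈0⇒x≈0∨y≈0 : ∀ {x y} → x * y ≈ 0# → x ≈ 0# ⊎ y ≈ 0#
  xy≈0⇒x≈0∨y≈0 {x} xy≈0 with x ≟ 0#
  ... | yes x≈0 = inj₁ x≈0
  ... | no x≉0  = inj₂ (x≉0∧xy≈0⇒y≈0 x≉0 xy≈0)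

  x²≈0⇒x≈0 : ∀ {x} → x * x ≈ 0# → x ≈ 0#
  x²≈0⇒x≈0 x²≈0 with xy≈0⇒x≈0∨y≈0 x²≈0
  ... | inj₁ x≈0 = x≈0
  ... | inj₂ x≈0 = x≈0

  private
    product-const : ∀ {K} (f : Fin K → Carrier) {y} → (∀ j → f j ≈ y) → product f ≈ pow y K
    product-const {ℕ.zero}  f f≈y = refl
    product-const {ℕ.suc K} f f≈y = *-cong (f≈y Fin.zero) (product-const (λ j → f (Fin.suc j)) (λ j → f≈y (Fin.suc j)))

    product-one-out : ∀ {K} (f : Fin (ℕ.suc K) → Carrier) {y} j₀ → f j₀ ≈ 1# → (∀ j → j ≢ j₀ → f j ≈ y) →
                      product f ≈ pow y K
    product-one-out f Fin.zero f₀≈1 f≈y =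
      trans (*-cong f₀≈1 (product-const (λ j → f (Fin.suc j)) (λ j → f≈y (Fin.suc j) λ ()))) (*-identityˡ _)
    product-one-out {ℕ.suc K} f (Fin.suc j₀) f₀≈1 f≈y =
      *-cong (f≈y Fin.zero λ ()) (product-one-out (λ j → f (Fin.suc j)) j₀ f₀≈1
        (λ j j≢j₀ → f≈y (Fin.suc j) λ e → j≢j₀ (suc-injective e)))

    product-nonzero : ∀ {K} (f : Fin K → Carrier) → (∀ j → f j ≉ 0#) → product f ≉ 0#
    product-nonzero {ℕ.zero}  f f≉0 1≈0 = 0≉1 (sym 1≈0)
    product-nonzero {ℕ.suc K} f f≉0 = *-nonzero (f≉0 Fin.zero) (product-nonzero (λ j → f (Fin.suc j)) (λ j → f≉0 (Fin.suc j)))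

    unit : Carrier → Carrier
    unit y with y ≟ 0#
    ... | yes _ = 1#
    ... | no _  = y

    unit≉0 : ∀ y → unit y ≉ 0#
    unit≉0 y with y ≟ 0#
    ... | yes _   = λ 1≈0 → 0≉1 (sym 1≈0)
    ... | no y≉0  = y≉0

    module Scaling (x : Carrier) (x≉0 : x ≉ 0#) where
      factor : Carrier → Carrier
      factor y with y ≟ 0#
      ... | yes _ = 1#
      ... | no _  = x

      unit-scaled : ∀ {y z} → z ≈ x * y → unit z ≈ factor y * unit y
      unit-scaled {y} {z} z≈xy with z ≟ 0# | y ≟ 0#
      ... | yes _   | yes _   = sym (*-identityˡ 1#)
      ... | no _    | no _    = z≈xy
      ... | yes z≈0 | no y≉0  = contradiction (trans (sym z≈xy) z≈0) (*-nonzero x≉0 y≉0)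
      ... | no z≉0  | yes y≈0 = contradiction (trans z≈xy (trans (*-congˡ y≈0) (zeroʳ x))) z≉0

      x⁻¹ : Carrier
      x⁻¹ = inv x x≉0

      σ τ : Fin (ℕ.suc M) → Fin (ℕ.suc M)
      σ i = to⁻ (x * to i)
      τ i = to⁻ (x⁻¹ * to i)

      cancel : ∀ u v w → u * v ≈ 1# → u * (v * w) ≈ w
      cancel u v w uv≈1 = trans (sym (*-assoc u v w)) (trans (*-congʳ uv≈1) (*-identityˡ w))

      multiplication : Permutation (ℕ.suc M) (ℕ.suc M)
      multiplication = permutation σ τ
        (λ i → injective (trans (to∘to⁻ _) (trans (*-congˡ (to∘to⁻ _)) (cancel x x⁻¹ (to i) (*-inverseʳ x x≉0)))))
        (λ i → injective (trans (to∘to⁻ _) (trans (*-congˡ (to∘to⁻ _)) (cancel x⁻¹ x (to i) (*-inverseˡ x x≉0)))))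

      product-factor : product (λ i → factor (to i)) ≈ pow x M
      product-factor = product-one-out _ (to⁻ 0#) at-zero elsewhere
        where
        at-zero : factor (to (to⁻ 0#)) ≈ 1#
        at-zero with to (to⁻ 0#) ≟ 0#
        ... | yes _   = refl
        ... | no ≉0   = contradiction (to∘to⁻ 0#) ≉0
        elsewhere : ∀ j → j ≢ to⁻ 0# → factor (to j) ≈ x
        elsewhere j j≢ with to j ≟ 0#
        ... | yes ≈0  = contradiction (injective (trans ≈0 (sym (to∘to⁻ 0#)))) j≢
        ... | no _    = refl

  -- Multiplication by x ≉ 0 permutes the elements; comparing the products of all elements
  -- (each 0 counted as 1) before and after the permutation gives x ^ M ≈ 1.
  fermat : ∀ x → pow x (ℕ.suc M) ≈ x
  fermat x with x ≟ 0#
  ... | yes x≈0 = trans (*-congʳ x≈0) (trans (zeroˡ _) (sym x≈0))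
  ... | no x≉0  = trans (*-congˡ x^M≈1) (*-identityʳ x)
    where
    open Scaling x x≉0
    units : Fin (ℕ.suc M) → Carrier
    units i = unit (to i)
    x^M≈1 : pow x M ≈ 1#
    x^M≈1 = *-cancelʳ (product-nonzero units (λ i → unit≉0 (to i))) (begin
      pow x M * product units                            ≈⟨ *-congʳ (sym product-factor) ⟩
      product (λ i → factor (to i)) * product units      ≈⟨ sym (∑-distrib-+ (λ i → factor (to i)) units) ⟩
      product (λ i → factor (to i) * units i)            ≈⟨ sym (sum-cong-≋ (λ i → unit-scaled (to∘to⁻ (x * to i)))) ⟩
      product (λ i → units (σ i))                        ≈⟨ sym (sum-permute units multiplication) ⟩
      product units                                      ≈⟨ sym (*-identityˡ _) ⟩
      1# * product units                                 ∎)

  pow-pow-quotient : ∀ {k} (k∣ : k ∣ ℕ.suc M) x → pow (pow x k) (quotient k∣) ≈ x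
  pow-pow-quotient {k} (divides l M+1≡lk) x = begin
    pow (pow x k) l    ≈⟨ pow-assocʳ x k l ⟩
    pow x (k ℕ.* l)    ≡⟨ ≡.cong (pow x) (≡.trans (ℕP.*-comm k l) (≡.sym M+1≡lk)) ⟩
    pow x (ℕ.suc M)    ≈⟨ fermat x ⟩
    x                  ∎

  pow-injective : ∀ {k} → k ∣ ℕ.suc M → ∀ {x y} → pow x k ≈ pow y k → x ≈ y
  pow-injective {k} k∣ {x} {y} xᵏ≈yᵏ = begin
    x                             ≈⟨ sym (pow-pow-quotient k∣ x) ⟩
    pow (pow x k) (quotient k∣)   ≈⟨ pow-congˡ (quotient k∣) xᵏ≈yᵏ ⟩
    pow (pow y k) (quotient k∣)   ≈⟨ pow-pow-quotient k∣ y ⟩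
    y                             ∎

  pow≉0⇒≉0 : ∀ {k} → k ∣ ℕ.suc M → ∀ {x} → pow x k ≉ 0# → x ≉ 0#
  pow≉0⇒≉0 {ℕ.zero}  0∣ = contradiction (0∣⇒≡0 0∣) λ ()
  pow≉0⇒≉0 {ℕ.suc k} _ xᵏ≉0 x≈0 = xᵏ≉0 (trans (pow-congˡ (ℕ.suc k) x≈0) (pow-0# (ℕ.suc k)))

  -- s = (-1)^k satisfies s² ≈ 1, so s ≈ ±1; and s ≈ 1 would force -1 ≈ s ^ ((M + 1) / k) ≈ 1.
  pow-neg1 : ∀ {k} → k ∣ ℕ.suc M → pow (- 1#) k ≈ - 1#
  pow-neg1 {k} k∣ = ±1 (xy≈0⇒x≈0∨y≈0 factored)
    where
    s : Carrier
    s = pow (- 1#) k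

    s²≈1 : s * s ≈ 1#
    s²≈1 = begin
      s * s                ≈⟨ sym (pow-distrib-* (- 1#) (- 1#) k) ⟩
      pow (- 1# * - 1#) k  ≈⟨ pow-congˡ k (solve 0 (:- con (+ 1) :* :- con (+ 1) := con (+ 1)) refl) ⟩
      pow 1# k             ≈⟨ pow-1# k ⟩
      1#                   ∎

    factored : (s - 1#) * (s + 1#) ≈ 0#
    factored = trans (solve 1 (λ s → (s :- con (+ 1)) :* (s :+ con (+ 1)) := s :* s :- con (+ 1)) refl s)
                     (x≈y⇒x∙y⁻¹≈ε s²≈1)

    ±1 : s - 1# ≈ 0# ⊎ s + 1# ≈ 0# → s ≈ - 1#
    ±1 (inj₂ s+1≈0) = inverseˡ-unique s 1# s+1≈0
    ±1 (inj₁ s-1≈0) = trans s≈1 (sym -1≈1)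
      where
      s≈1 : s ≈ 1#
      s≈1 = x∙y⁻¹≈ε⇒x≈y s 1# s-1≈0
      -1≈1 : - 1# ≈ 1#
      -1≈1 = begin
        - 1#                          ≈⟨ sym (pow-pow-quotient k∣ (- 1#)) ⟩
        pow s (quotient k∣)           ≈⟨ pow-congˡ (quotient k∣) s≈1 ⟩
        pow 1# (quotient k∣)          ≈⟨ pow-1# (quotient k∣) ⟩
        1#                            ∎

  pow-neg : ∀ {k} → k ∣ ℕ.suc M → ∀ x → pow (- x) k ≈ - pow x k
  pow-neg {k} k∣ x = begin
    pow (- x) k              ≈⟨ pow-congˡ k (sym (-1*x≈-x x)) ⟩
    pow (- 1# * x) k         ≈⟨ pow-distrib-* (- 1#) x k ⟩
    pow (- 1#) k * pow x k   ≈⟨ *-congʳ (pow-neg1 k∣) ⟩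
    - 1# * pow x k           ≈⟨ -1*x≈-x (pow x k) ⟩
    - pow x k                ∎

module EqualPrincipalMinorsFacts {c ℓ} (R : CommutativeRing c ℓ) {m : ℕ}
                                 (A B : Over.Matrix R (ℕ.suc m)) (equalMinors : Over.EqualPrincipalMinors R A B) where
  open CommutativeRing R hiding (zero)
  open Over R
  open Determinants R
  open SubsetElements
  open import Algebra.Properties.Group +-group using (∙-cancelˡ; ⁻¹-injective)
  open import Data.Bool using (true)
  open import Data.Fin using (zero; suc; _<_)
  open import Data.Fin.Properties using (<-cmp; <-irrefl; suc-injective)
  open import Data.Fin.Subset using (⁅_⁆; _∪_)
  open import Data.List using (List; []; _∷_; map; length; lookup)
  open import Data.Vec using (_∷_)
  open import Relation.Binary.Definitions using (tri<; tri≈; tri>)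
  open import Relation.Binary.PropositionalEquality as ≡ using (_≡_; _≢_)
  open import Relation.Nullary using (contradiction)
  open import Relation.Binary.Reasoning.Setoid setoid

  private
    N : ℕ
    N = ℕ.suc m

    minorOn : Matrix N → (xs : List (Fin N)) → Matrix (length xs)
    minorOn X xs r s = X (lookup xs r) (lookup xs s)

    equalMinorsOn : ∀ α {xs} → elems α ≡ xs → det (minorOn A xs) ≈ det (minorOn B xs)
    equalMinorsOn α ≡.refl = equalMinors α

  diagonal-≈ : ∀ i → A i i ≈ B i i
  diagonal-≈ i = begin
    A i i                      ≈⟨ sym (det₁ (minorOn A (i ∷ []))) ⟩
    det (minorOn A (i ∷ []))   ≈⟨ equalMinorsOn ⁅ i ⁆ (elems-⁅⁆ i) ⟩
    det (minorOn B (i ∷ []))   ≈⟨ det₁ (minorOn B (i ∷ [])) ⟩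
    B i i                      ∎

  private
    2-cycle-≈-< : ∀ {i j} → i < j → A i j * A j i ≈ B i j * B j i
    2-cycle-≈-< {i} {j} i<j = ⁻¹-injective (∙-cancelˡ (A i i * A j j) _ _ (begin
      A i i * A j j - A i j * A j i  ≈⟨ sym (det₂ (minorOn A (i ∷ j ∷ []))) ⟩
      det (minorOn A (i ∷ j ∷ []))    ≈⟨ equalMinorsOn (⁅ i ⁆ ∪ ⁅ j ⁆) (elems-⁅⁆∪⁅⁆ i<j) ⟩
      det (minorOn B (i ∷ j ∷ []))    ≈⟨ det₂ (minorOn B (i ∷ j ∷ [])) ⟩
      B i i * B j j - B i j * B j i  ≈⟨ +-congʳ (sym (*-cong (diagonal-≈ i) (diagonal-≈ j))) ⟩
      A i i * A j j - B i j * B j i  ∎))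

  2-cycle-≈ : ∀ {i j} → i ≢ j → A i j * A j i ≈ B i j * B j i
  2-cycle-≈ {i} {j} i≢j with <-cmp i j
  ... | tri< i<j _ _ = 2-cycle-≈-< i<j
  ... | tri≈ _ i≡j _ = contradiction i≡j i≢j
  ... | tri> _ _ j<i = trans (*-comm _ _) (trans (2-cycle-≈-< j<i) (*-comm _ _))

  private
    3-cycles-≈-< : ∀ {u v : Fin m} → u < v →
      cycle₃ A zero (suc u) (suc v) + cycle₃ A zero (suc v) (suc u) ≈ cycle₃ B zero (suc u) (suc v) + cycle₃ B zero (suc v) (suc u)
    3-cycles-≈-< {u} {v} u<v = ∙-cancelˡ (noncyclic A) _ _ (begin
      noncyclic A + (cycle₃ A zero u′ v′ + cycle₃ A zero v′ u′) ≈⟨ sym (det₃ (minorOn A xs)) ⟩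
      det (minorOn A xs)
        ≈⟨ equalMinorsOn (true ∷ (⁅ u ⁆ ∪ ⁅ v ⁆)) (≡.cong (λ ys → zero ∷ map suc ys) (elems-⁅⁆∪⁅⁆ u<v)) ⟩
      det (minorOn B xs)                                     ≈⟨ det₃ (minorOn B xs) ⟩
      noncyclic B + (cycle₃ B zero u′ v′ + cycle₃ B zero v′ u′) ≈⟨ +-congʳ (sym noncyclic-≈) ⟩
      noncyclic A + (cycle₃ B zero u′ v′ + cycle₃ B zero v′ u′) ∎)
      where
      u′ v′ : Fin N
      u′ = suc u
      v′ = suc v
      xs : List (Fin N)
      xs = zero ∷ u′ ∷ v′ ∷ []
      noncyclic : Matrix N → Carrier
      noncyclic X = X zero zero * X u′ u′ * X v′ v′
                    - (X zero zero * (X u′ v′ * X v′ u′) + X u′ u′ * (X zero v′ * X v′ zero)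
                       + X v′ v′ * (X zero u′ * X u′ zero))
      u′≢v′ : u′ ≢ v′
      u′≢v′ e = <-irrefl (suc-injective e) u<v
      noncyclic-≈ : noncyclic A ≈ noncyclic B
      noncyclic-≈ = +-cong (*-cong (*-cong (diagonal-≈ _) (diagonal-≈ _)) (diagonal-≈ _))
        (-‿cong (+-cong (+-cong (*-cong (diagonal-≈ _) (2-cycle-≈ u′≢v′))
                                (*-cong (diagonal-≈ _) (2-cycle-≈ λ ())))
                        (*-cong (diagonal-≈ _) (2-cycle-≈ λ ()))))

  3-cycles-≈ : ∀ {u v : Fin m} → u ≢ v →
    cycle₃ A zero (suc u) (suc v) + cycle₃ A zero (suc v) (suc u) ≈ cycle₃ B zero (suc u) (suc v) + cycle₃ B zero (suc v) (suc u)
  3-cycles-≈ {u} {v} u≢v with <-cmp u v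
  ... | tri< u<v _ _ = 3-cycles-≈-< u<v
  ... | tri≈ _ u≡v _ = contradiction u≡v u≢v
  ... | tri> _ _ v<u = trans (+-comm _ _) (trans (3-cycles-≈-< v<u) (+-comm _ _))

module RankOne {c ℓ} (F : CommutativeRing c ℓ) (isField : Over.IsField F) {n : ℕ}
               (C : Over.Matrix F n) (rank₁ : Over.HasRank F C 1) where
  open CommutativeRing F hiding (zero)
  open Over F
  open Determinants F
  open FieldFacts F isField
  open import Algebra.Properties.Group +-group using (x∙y⁻¹≈ε⇒x≈y)
  import Data.Fin as Fin
  open import Data.Fin.Patterns using (0F; 1F)
  open import Data.Product using (∃; ∃₂; _,_; proj₁; proj₂)
  open import Function.Definitions using (Injective)
  open import Relation.Binary.PropositionalEquality as ≡ using (_≡_; _≢_)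
  open import Relation.Nullary using (yes; no; contradiction)

  ∃-entry≉0 : ∃₂ λ r s → C r s ≉ 0#
  ∃-entry≉0 with proj₁ rank₁
  ... | ρ , κ , _ , _ , minor≉0 = ρ 0F , κ 0F , λ Crs≈0 → minor≉0 (trans (det₁ (subMatrix C ρ κ)) Crs≈0)

  private
    pair : Fin n → Fin n → Fin 2 → Fin n
    pair i k 0F = i
    pair i k 1F = k

    pair-injective : ∀ {i k} → i ≢ k → Injective _≡_ _≡_ (pair i k)
    pair-injective i≢k {0F} {0F} _ = ≡.refl
    pair-injective i≢k {0F} {1F} e = contradiction e i≢k
    pair-injective i≢k {1F} {0F} e = contradiction (≡.sym e) i≢k
    pair-injective i≢k {1F} {1F} _ = ≡.refl

  minor₂≈0 : ∀ i j k l → C i j * C k l ≈ C i l * C k j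
  minor₂≈0 i j k l with i Fin.≟ k | j Fin.≟ l
  ... | yes ≡.refl | _          = *-comm _ _
  ... | no _       | yes ≡.refl = refl
  ... | no i≢k     | no j≢l     = x∙y⁻¹≈ε⇒x≈y _ _ (trans (sym (det₂ (subMatrix C (pair i k) (pair j l))))
                                   (proj₂ rank₁ (pair i k) (pair j l) (pair-injective i≢k) (pair-injective j≢l)))

  rows∧columns≉0⇒entries≉0 : (∀ i → ∃ λ l → C i l ≉ 0#) → (∀ j → ∃ λ k → C k j ≉ 0#) → ∀ i j → C i j ≉ 0#
  rows∧columns≉0⇒entries≉0 rows columns i j Cij≈0 with rows i | columns j
  ... | l , Cil≉0 | k , Ckj≉0 =
    *-nonzero Cil≉0 Ckj≉0 (trans (sym (minor₂≈0 i j k l)) (trans (*-congʳ Cij≈0) (zeroˡ _)))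

module RankOnePerturbedDickson {c ℓ} (F : CommutativeRing c ℓ) (isField : Over.IsField F)
    {M : ℕ} (card : Over.HasCardinality F (ℕ.suc M)) {q m : ℕ} (qⁿ≡M+1 : q ^ ℕ.suc m ≡ ℕ.suc M)
    {A : Over.Matrix F (ℕ.suc m)} (dickson : Over.IsDickson F q A) (d : CommutativeRing.Carrier F)
    (rank₁ : Over.HasRank F (Over._+ᴹ_ F A (Over.diag F (λ i → Over.pow F d (q ^ toℕ i)))) 1) where
  open CommutativeRing F hiding (zero)
  open Over F
  open Determinants F using (cycle₃)
  open FieldFacts F isField
  open FiniteFieldFacts F isField card
  open PowerLaws F
  open CyclicIndices {m}
  open import Algebra.Solver.CommutativeMonoid *-commutativeMonoid using (_⊕_; _⊜_) renaming (solve to ⊙-solve)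
  open import Algebra.Properties.Group +-group using (inverseˡ-unique)
  import Data.Fin as Fin
  open import Data.Fin using (zero; suc)
  open import Data.Fin.Properties using (toℕ<n)
  open import Data.Nat.Divisibility using (_∣_; divides)
  open import Data.Nat.Properties using (^-distribˡ-+-*; m∸n+n≡m; <⇒≤)
  open import Data.Product using (∃; _×_; _,_; proj₁; proj₂)
  open import Function using (_∘_)
  open import Relation.Binary.PropositionalEquality as ≡ using (_≡_; _≢_)
  open import Relation.Nullary using (Dec; yes; no; contradiction)
  open import Relation.Binary.Reasoning.Setoid setoid

  private
    N : ℕ
    N = ℕ.suc m

    Q : Fin N → ℕ
    Q i = q ^ toℕ i

    C : Matrix N
    C = A +ᴹ diag (λ i → pow d (Q i))

    a : Fin N → Carrier
    a = proj₁ dickson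

    A≈ : ∀ i j → A i j ≈ pow (a (j ⊖ i)) (Q i)
    A≈ = proj₂ dickson

    Q∣ : ∀ i → Q i ∣ ℕ.suc M
    Q∣ i = divides (q ^ (N ℕ.∸ toℕ i)) (≡.trans (≡.sym qⁿ≡M+1)
      (≡.trans (≡.cong (q ^_) (≡.sym (m∸n+n≡m (<⇒≤ (toℕ<n i))))) (^-distribˡ-+-* q (N ℕ.∸ toℕ i) (toℕ i))))

  open RankOne F isField C rank₁

  private
    C-off : ∀ {i j} → i ≢ j → C i j ≈ A i j
    C-off {i} {j} i≢j with i Fin.≟ j
    ... | yes i≡j = contradiction i≡j i≢j
    ... | no _    = +-identityʳ _

    a₀ : Carrier
    a₀ = a zero

    C-diag : ∀ i → C i i ≈ pow a₀ (Q i) + pow d (Q i)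
    C-diag i with i Fin.≟ i
    ... | yes _  = +-congʳ (trans (A≈ i i) (reflexive (≡.cong (λ k → pow (a k) (Q i)) (⊖-self i))))
    ... | no i≢i = contradiction ≡.refl i≢i

    diagonal≈0⇒a₀≈-d : ∀ i → C i i ≈ 0# → a₀ ≈ - d
    diagonal≈0⇒a₀≈-d i Cii≈0 = pow-injective (Q∣ i) (begin
      pow a₀ (Q i)     ≈⟨ inverseˡ-unique _ _ (trans (sym (C-diag i)) Cii≈0) ⟩
      - pow d (Q i)    ≈⟨ sym (pow-neg (Q∣ i) d) ⟩
      pow (- d) (Q i)  ∎)

    a₀≈-d⇒diagonal≈0 : a₀ ≈ - d → ∀ i → C i i ≈ 0#
    a₀≈-d⇒diagonal≈0 a₀≈-d i = begin
      C i i                          ≈⟨ C-diag i ⟩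
      pow a₀ (Q i) + pow d (Q i)     ≈⟨ +-congʳ (trans (pow-congˡ (Q i) a₀≈-d) (pow-neg (Q∣ i) d)) ⟩
      - pow d (Q i) + pow d (Q i)    ≈⟨ -‿inverseˡ _ ⟩
      0#                             ∎

    diagonal≉0 : ∀ {r} → C r r ≉ 0# → ∀ i → C i i ≉ 0#
    diagonal≉0 {r} Crr≉0 i Cii≈0 = Crr≉0 (a₀≈-d⇒diagonal≈0 (diagonal≈0⇒a₀≈-d i Cii≈0) r)

    -- All entries on the cyclic diagonal j ⊖ i ≡ s ⊖ r are Frobenius twists of C r s.
    diagonalOf≉0 : ∀ {r s} → r ≢ s → C r s ≉ 0# → ∀ {i j} → j ⊖ i ≡ s ⊖ r → C i j ≉ 0#
    diagonalOf≉0 {r} {s} r≢s Crs≉0 {i} {j} j⊖i≡s⊖r Cij≈0 = pow-nonzero (Q i) aₖ≉0 (begin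
      pow (a (s ⊖ r)) (Q i)  ≡⟨ ≡.cong (λ k → pow (a k) (Q i)) (≡.sym j⊖i≡s⊖r) ⟩
      pow (a (j ⊖ i)) (Q i)  ≈⟨ sym (A≈ i j) ⟩
      A i j                  ≈⟨ sym (C-off i≢j) ⟩
      C i j                  ≈⟨ Cij≈0 ⟩
      0#                     ∎)
      where
      aₖ≉0 : a (s ⊖ r) ≉ 0#
      aₖ≉0 = pow≉0⇒≉0 (Q∣ r) λ aₖ^Q≈0 → Crs≉0 (trans (C-off r≢s) (trans (A≈ r s) aₖ^Q≈0))
      i≢j : i ≢ j
      i≢j ≡.refl = r≢s (≡.sym (⊖≡zero⇒≡ (≡.trans (≡.sym j⊖i≡s⊖r) (⊖-self i))))

    Lines≉0 : Set ℓ
    Lines≉0 = (∀ i → ∃ λ l → C i l ≉ 0#) × (∀ j → ∃ λ k → C k j ≉ 0#)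

    entry≉0⇒lines≉0 : ∀ {r s} → C r s ≉ 0# → Dec (r ≡ s) → Lines≉0
    entry≉0⇒lines≉0 Crr≉0 (yes ≡.refl) = (λ i → i , diagonal≉0 Crr≉0 i) , (λ j → j , diagonal≉0 Crr≉0 j)
    entry≉0⇒lines≉0 {r} {s} Crs≉0 (no r≢s) =
      (λ i → let j , e = ∃-⊖≡ʳ i (s ⊖ r) in j , diagonalOf≉0 r≢s Crs≉0 e) ,
      (λ j → let i , e = ∃-⊖≡ˡ j (s ⊖ r) in i , diagonalOf≉0 r≢s Crs≉0 e)

    lines≉0 : Lines≉0
    lines≉0 with ∃-entry≉0
    ... | r , s , Crs≉0 = entry≉0⇒lines≉0 Crs≉0 (r Fin.≟ s)

  offDiagonal≉0 : ∀ {i j} → i ≢ j → A i j ≉ 0#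
  offDiagonal≉0 {i} {j} i≢j Aij≈0 =
    rows∧columns≉0⇒entries≉0 (proj₁ lines≉0) (proj₂ lines≉0) i j (trans (C-off i≢j) Aij≈0)

  cycle₃-symmetric : ∀ {u v} → zero ≢ u → zero ≢ v → u ≢ v → cycle₃ A zero u v ≈ cycle₃ A zero v u
  cycle₃-symmetric {u} {v} 0≢u 0≢v u≢v = begin
    A zero u * A u v * A v zero   ≈⟨ sym (*-cong (*-cong (C-off 0≢u) (C-off u≢v)) (C-off (0≢v ∘ ≡.sym))) ⟩
    C zero u * C u v * C v zero   ≈⟨ ⊙-solve 3 (λ x y z → (x ⊕ y) ⊕ z ⊜ (x ⊕ z) ⊕ y) refl _ _ _ ⟩
    (C zero u * C v zero) * C u v ≈⟨ *-congʳ (minor₂≈0 zero u v zero) ⟩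
    (C zero zero * C v u) * C u v ≈⟨ ⊙-solve 3 (λ x y z → (x ⊕ y) ⊕ z ⊜ (x ⊕ z) ⊕ y) refl _ _ _ ⟩
    (C zero zero * C u v) * C v u ≈⟨ *-congʳ (sym (minor₂≈0 zero v u zero)) ⟩
    (C zero v * C u zero) * C v u ≈⟨ ⊙-solve 3 (λ x y z → (x ⊕ y) ⊕ z ⊜ (x ⊕ z) ⊕ y) refl _ _ _ ⟩
    C zero v * C v u * C u zero   ≈⟨ *-cong (*-cong (C-off 0≢v) (C-off (u≢v ∘ ≡.sym))) (C-off (0≢u ∘ ≡.sym)) ⟩
    A zero v * A v u * A u zero   ∎

module ThreeCycleRigidity {c ℓ} (F : CommutativeRing c ℓ) (isField : Over.IsField F) where
  open CommutativeRing F hiding (zero)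
  open Over F
  open Determinants F using (cycle₃; cycle₃*reversed)
  open FieldFacts F isField
  open DiagonalScaling F using (rescaling⇒diagonallySimilar)
  open IntegerCoefficientSolver F using (solve; _:=_; _:*_; _:+_; _:-_; con)
  open import Algebra.Properties.Group +-group using (x∙y⁻¹≈ε⇒x≈y)
  open import Data.Integer using (+_)
  open import Algebra.Solver.CommutativeMonoid *-commutativeMonoid using (_⊕_; _⊜_; id) renaming (solve to ⊙-solve)
  open import Data.Fin using (zero; suc)
  import Data.Fin as Fin
  open import Data.Fin.Properties using (suc-injective)
  open import Relation.Binary.PropositionalEquality as ≡ using (_≡_; _≢_)
  open import Relation.Nullary using (Dec; yes; no)
  open import Relation.Binary.Reasoning.Setoid setoid

  module _ (x²≈0⇒x≈0 : ∀ {x} → x * x ≈ 0# → x ≈ 0#)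
           {m : ℕ} {A B : Matrix (ℕ.suc m)} (equalMinors : EqualPrincipalMinors A B)
           (offDiagonal≉0 : ∀ {i j} → i ≢ j → A i j ≉ 0#)
           (cycle₃-symmetric : ∀ {u v} → zero ≢ u → zero ≢ v → u ≢ v → cycle₃ A zero u v ≈ cycle₃ A zero v u)
           where
    open EqualPrincipalMinorsFacts F A B equalMinors

    -- x and x′ are the roots of (t - y)².
    x+x′≈y+y∧xx′≈yy⇒x≈y : ∀ {x x′ y} → x + x′ ≈ y + y → x * x′ ≈ y * y → x ≈ y
    x+x′≈y+y∧xx′≈yy⇒x≈y {x} {x′} {y} sum≈ product≈ = x∙y⁻¹≈ε⇒x≈y x y (x²≈0⇒x≈0 (begin
      (x - y) * (x - y)               ≈⟨ solve 2 (λ x y → (x :- y) :* (x :- y) := x :* x :- x :* (y :+ y) :+ y :* y) refl x y ⟩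
      x * x - x * (y + y) + y * y     ≈⟨ +-cong (+-congˡ (-‿cong (*-congˡ (sym sum≈)))) (sym product≈) ⟩
      x * x - x * (x + x′) + x * x′   ≈⟨ solve 2 (λ x x′ → x :* x :- x :* (x :+ x′) :+ x :* x′ := con (+ 0)) refl x x′ ⟩
      0#                              ∎))

    cycle₃-≈ : ∀ {i j : Fin m} → i ≢ j → cycle₃ B zero (suc i) (suc j) ≈ cycle₃ A zero (suc i) (suc j)
    cycle₃-≈ {i} {j} i≢j = x+x′≈y+y∧xx′≈yy⇒x≈y
      (trans (sym (3-cycles-≈ i≢j)) (+-congˡ (sym symmetric)))
      (begin
        cycle₃ B zero u v * cycle₃ B zero v u
          ≈⟨ cycle₃*reversed B zero u v ⟩
        (B zero u * B u zero) * (B u v * B v u) * (B v zero * B zero v)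
          ≈⟨ sym (*-cong (*-cong (2-cycle-≈ λ ()) (2-cycle-≈ u≢v)) (2-cycle-≈ λ ())) ⟩
        (A zero u * A u zero) * (A u v * A v u) * (A v zero * A zero v)
          ≈⟨ sym (cycle₃*reversed A zero u v) ⟩
        cycle₃ A zero u v * cycle₃ A zero v u
          ≈⟨ *-congˡ (sym symmetric) ⟩
        cycle₃ A zero u v * cycle₃ A zero u v ∎)
      where
      u v : Fin (ℕ.suc m)
      u = suc i
      v = suc j
      u≢v : u ≢ v
      u≢v e = i≢j (suc-injective e)
      symmetric : cycle₃ A zero u v ≈ cycle₃ A zero v u
      symmetric = cycle₃-symmetric (λ ()) (λ ()) u≢v

    private
      α β : Fin m → Carrier
      α j = A zero (suc j)
      β j = B zero (suc j)

      α≉0 : ∀ j → α j ≉ 0#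
      α≉0 j = offDiagonal≉0 λ ()

      β≉0 : ∀ j → β j ≉ 0#
      β≉0 j βj≈0 = *-nonzero (offDiagonal≉0 λ ()) (offDiagonal≉0 λ ())
        (trans (2-cycle-≈ λ ()) (trans (*-congʳ βj≈0) (zeroˡ _)))

      α⁻¹ β⁻¹ : Fin m → Carrier
      α⁻¹ j = inv (α j) (α≉0 j)
      β⁻¹ j = inv (β j) (β≉0 j)

      -- rescale so that the first row of A becomes that of B
      δ ε : Fin (ℕ.suc m) → Carrier
      δ zero    = 1#
      δ (suc j) = β j * α⁻¹ j
      ε zero    = 1#
      ε (suc j) = α j * β⁻¹ j

      δε≈1 : ∀ i → δ i * ε i ≈ 1#
      δε≈1 zero    = *-identityˡ 1#
      δε≈1 (suc j) = begin
        (β j * α⁻¹ j) * (α j * β⁻¹ j)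
          ≈⟨ ⊙-solve 4 (λ b b′ a a′ → (b ⊕ a′) ⊕ (a ⊕ b′) ⊜ (b ⊕ b′) ⊕ (a ⊕ a′)) refl (β j) (β⁻¹ j) (α j) (α⁻¹ j) ⟩
        (β j * β⁻¹ j) * (α j * α⁻¹ j)
          ≈⟨ *-cong (*-inverseʳ (β j) (β≉0 j)) (*-inverseʳ (α j) (α≉0 j)) ⟩
        1# * 1#                        ≈⟨ *-identityˡ 1# ⟩
        1#                             ∎

      B-column≉0 : ∀ j → B (suc j) zero ≉ 0#
      B-column≉0 j Bj0≈0 = *-nonzero (offDiagonal≉0 λ ()) (offDiagonal≉0 λ ())
        (trans (2-cycle-≈ λ ()) (trans (*-congˡ Bj0≈0) (zeroʳ _)))

      rescaled-diagonal : ∀ i → B (suc i) (suc i) ≈ ε (suc i) * A (suc i) (suc i) * δ (suc i)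
      rescaled-diagonal i = sym (begin
        ε u * A u u * δ u                  ≈⟨ ⊙-solve 3 (λ e a d → (e ⊕ a) ⊕ d ⊜ (d ⊕ e) ⊕ a) refl (ε u) (A u u) (δ u) ⟩
        (δ u * ε u) * A u u                ≈⟨ *-congʳ (δε≈1 u) ⟩
        1# * A u u                         ≈⟨ *-identityˡ _ ⟩
        A u u                              ≈⟨ diagonal-≈ u ⟩
        B u u                              ∎)
        where
        u : Fin (ℕ.suc m)
        u = suc i

      -- Multiplied by w, both sides become α i · A u v · β j · B v 0, by the 3-cycle 0 → u → v → 0
      -- and the 2-cycle 0 ↔ v.
      rescaled-offDiagonal : ∀ {i j} → i ≢ j → B (suc i) (suc j) ≈ ε (suc i) * A (suc i) (suc j) * δ (suc j)
      rescaled-offDiagonal {i} {j} i≢j = *-cancelʳ w≉0 (begin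
        B u v * w
          ≈⟨ ⊙-solve 4 (λ x b y a → x ⊕ ((b ⊕ y) ⊕ a) ⊜ ((b ⊕ x) ⊕ y) ⊕ a) refl (B u v) (β i) (B v zero) (α j) ⟩
        cycle₃ B zero u v * α j
          ≈⟨ *-congʳ (cycle₃-≈ i≢j) ⟩
        cycle₃ A zero u v * α j
          ≈⟨ ⊙-solve 4 (λ a x y c → ((a ⊕ x) ⊕ y) ⊕ c ⊜ (a ⊕ x) ⊕ (c ⊕ y)) refl (α i) (A u v) (A v zero) (α j) ⟩
        α i * A u v * (α j * A v zero)
          ≈⟨ *-congˡ (2-cycle-≈ λ ()) ⟩
        α i * A u v * (β j * B v zero)
          ≈⟨ sym unscale ⟩
        ε u * A u v * δ v * w ∎)
        where
        u v : Fin (ℕ.suc m)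
        u = suc i
        v = suc j
        w : Carrier
        w = β i * B v zero * α j
        w≉0 : w ≉ 0#
        w≉0 = *-nonzero (*-nonzero (β≉0 i) (B-column≉0 j)) (α≉0 j)
        unscale : ε u * A u v * δ v * w ≈ α i * A u v * (β j * B v zero)
        unscale = begin
          α i * β⁻¹ i * A u v * (β j * α⁻¹ j) * (β i * B v zero * α j)
            ≈⟨ ⊙-solve 8 (λ a b′ x b a′ c y a″ → (((a ⊕ b′) ⊕ x) ⊕ (b ⊕ a′)) ⊕ ((c ⊕ y) ⊕ a″)
                                               ⊜ ((a ⊕ x) ⊕ (b ⊕ y)) ⊕ ((b′ ⊕ c) ⊕ (a′ ⊕ a″)))
                 refl (α i) (β⁻¹ i) (A u v) (β j) (α⁻¹ j) (β i) (B v zero) (α j) ⟩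
          α i * A u v * (β j * B v zero) * ((β⁻¹ i * β i) * (α⁻¹ j * α j))
            ≈⟨ *-congˡ (*-cong (*-inverseˡ (β i) (β≉0 i)) (*-inverseˡ (α j) (α≉0 j))) ⟩
          α i * A u v * (β j * B v zero) * (1# * 1#)
            ≈⟨ trans (*-congˡ (*-identityˡ 1#)) (*-identityʳ _) ⟩
          α i * A u v * (β j * B v zero) ∎

      B≈εAδ : ∀ i j → B i j ≈ ε i * A i j * δ j
      B≈εAδ zero    zero    = sym (trans (*-identityʳ _) (trans (*-identityˡ _) (diagonal-≈ zero)))
      B≈εAδ zero    (suc j) = sym (begin
        1# * α j * (β j * α⁻¹ j)
          ≈⟨ ⊙-solve 3 (λ a b a′ → (id ⊕ a) ⊕ (b ⊕ a′) ⊜ b ⊕ (a ⊕ a′)) refl (α j) (β j) (α⁻¹ j) ⟩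
        β j * (α j * α⁻¹ j)                ≈⟨ *-congˡ (*-inverseʳ (α j) (α≉0 j)) ⟩
        β j * 1#                           ≈⟨ *-identityʳ (β j) ⟩
        β j                                ∎)
      B≈εAδ (suc i) zero    = sym (begin
        α i * β⁻¹ i * A (suc i) zero * 1#
          ≈⟨ ⊙-solve 3 (λ a b′ x → ((a ⊕ b′) ⊕ x) ⊕ id ⊜ b′ ⊕ (a ⊕ x)) refl (α i) (β⁻¹ i) (A (suc i) zero) ⟩
        β⁻¹ i * (α i * A (suc i) zero)     ≈⟨ *-congˡ (2-cycle-≈ λ ()) ⟩
        β⁻¹ i * (β i * B (suc i) zero)     ≈⟨ sym (*-assoc _ _ _) ⟩
        (β⁻¹ i * β i) * B (suc i) zero     ≈⟨ *-congʳ (*-inverseˡ (β i) (β≉0 i)) ⟩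
        1# * B (suc i) zero                ≈⟨ *-identityˡ _ ⟩
        B (suc i) zero                     ∎)
      B≈εAδ (suc i) (suc j) = rescaled (i Fin.≟ j)
        where
        rescaled : Dec (i ≡ j) → B (suc i) (suc j) ≈ ε (suc i) * A (suc i) (suc j) * δ (suc j)
        rescaled (yes ≡.refl) = rescaled-diagonal i
        rescaled (no i≢j)     = rescaled-offDiagonal i≢j

    diagonallySimilar : DiagonallySimilar A B
    diagonallySimilar = rescaling⇒diagonallySimilar δ ε δε≈1 B≈εAδ

cardinality≡suc : ∀ {c ℓ} (F : CommutativeRing c ℓ) {N : ℕ} → Over.HasCardinality F N → ∃[ M ] N ≡ ℕ.suc M
cardinality≡suc F card = inhabited (proj₁ (Bijection.surjective card (CommutativeRing.0# F)))
  where
  inhabited : ∀ {N} → Fin N → ∃[ M ] N ≡ ℕ.suc M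
  inhabited {ℕ.suc M} _ = M , ≡.refl

mainTheorem13 : ∀ {c ℓ : Level} (F : CommutativeRing c ℓ) (q n : ℕ) .{{_ : NonZero n}} →
  let open CommutativeRing F using (Carrier)
      open Over F
  in IsPrimePower q → IsField → HasCardinality (q ^ n) →
     (A B : Matrix n) → IsDickson q A → IsDickson q B →
     (∃[ d ] HasRank (A +ᴹ diag (λ i → pow d (q ^ toℕ i))) 1) →
     EqualPrincipalMinors A B →
     DiagonallySimilar A B
mainTheorem13 F q ℕ.zero {{()}}
mainTheorem13 F q (ℕ.suc m) _ isField card A B dicksonA _ (d , rank₁) equalMinors with cardinality≡suc F card
... | M , qⁿ≡M+1 = diagonallySimilar x²≈0⇒x≈0 equalMinors offDiagonal≉0 cycle₃-symmetric
  where
  card′ : Over.HasCardinality F (ℕ.suc M)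
  card′ = ≡.subst (Over.HasCardinality F) qⁿ≡M+1 card
  open FiniteFieldFacts F isField card′ using (x²≈0⇒x≈0)
  open RankOnePerturbedDickson F isField card′ qⁿ≡M+1 dicksonA d rank₁ using (offDiagonal≉0; cycle₃-symmetric)
  open ThreeCycleRigidity F isField using (diagonallySimilar)
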